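{- Let $\mathbf c\in\mathbb Z_{\ge 0}^n$ and let $M$ be a proper $\mathbf c$-multicomplex. Then the Bier sphere $\mathrm{Bier}_{\mathbf c}(M)$ is shellable.
   Context: Fix $n\ge 1$ and $\mathbf c=(c_1,\dots,c_n)\in\mathbb Z_{\ge0}^n$; put $|\mathbf c|=c_1+\cdots+c_n$. For $\mathbf a\in\mathbb Z_{\ge0}^n$ write $x^{\mathbf a}=x_1^{a_1}\cdots x_n^{a_n}$. A $\mathbf c$-monomial is a monomial $x^{\mathbf a}$ with $a_i\le c_i$ for all $i$. A $\mathbf c$-multicomplex is a nonempty set $M$ of $\mathbf c$-monomials such that $u\in M$ and $v\mid u$ imply $v\in M$; it is called $\mathbf c$-full if it is the set of all $\mathbf c$-monomials and proper otherwise. Let $\widetilde X_i=\{x_i^{(0)},x_i^{(1)},\dots,x_i^{(c_i)}\}$ ($i=1,\dots,n$) be pairwise disjoint sets of new symbols and $\widetilde X=\bigcup_i\widetilde X_i$. For a $\mathbf c$-monomial $x^{\mathbf a}$ let $F_{\mathbf c}(x^{\mathbf a})=\widetilde X\setminus\{x_1^{(a_1)},\dots,x_n^{(a_n)}\}$, and for a $\mathbf c$-multicomplex $M$ let $\mathcal B_{\mathbf c}(M)$ be the simplicial complex on $\widetilde X$ whose faces are all subsets of the sets $F_{\mathbf c}(x^{\mathbf a})$, $x^{\mathbf a}\in M$. For a pure $(d-1)$-dimensional simplicial complex $B$, its boundary $\partial B$ is the simplicial complex generated by the $(d-1)$-element faces of $B$ contained in exactly one facet of $B$. For a proper $\mathbf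 c$-multicomplex $M$, the Bier sphere of $M$ is $\mathrm{Bier}_{\mathbf c}(M)=\partial\mathcal B_{\mathbf c}(M)$. A pure $(d-1)$-dimensional simplicial complex $\Delta$ is shellable if its facets admit an order $F_1,\dots,F_s$ such that for each $i\ge2$ the complex $\langle F_1,\dots,F_{i-1}\rangle\cap\langle F_i\rangle$ is generated by subsets of $F_i$ of cardinality $d-1$, where $\langle G_1,\dots,G_k\rangle$ denotes the set of all subsets of some $G_j$. -}

module Defs where

open import Data.Nat using (ℕ; zero; suc; _+_; _≤_)
open import Data.Fin using (Fin; toℕ; _≟_)
open import Data.Bool using (Bool; true; false; not; if_then_else_)
open import Data.List using (List; []; _∷_; map; concatMap; allFin; length; take; lookup)
open import Data.List.Relation.Unary.All using (All)
open import Data.List.Relation.Unary.Any using (Any)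
open import Data.List.Relation.Unary.AllPairs using (AllPairs)
open import Data.Product using (Σ; Σ-syntax; ∃; _×_; _,_)
open import Relation.Binary.PropositionalEquality using (_≡_)
open import Relation.Nullary using (¬_)
open import Relation.Nullary.Decidable using (⌊_⌋)

∣_∣ᶜ : ∀ {n} → (Fin n → ℕ) → ℕ
∣_∣ᶜ {zero}  c = 0
∣_∣ᶜ {suc n} c = c Fin.zero + ∣ (λ i → c (Fin.suc i)) ∣ᶜ

-- A c-monomial x^a, a_i ≤ c_i, is given by its exponent vector
-- a : (i : Fin n) → Fin (suc (c i)).
Mono : ∀ {n} → (Fin n → ℕ) → Set
Mono {n} c = (i : Fin n) → Fin (suc (c i))

_∣ᵐ_ : ∀ {n} {c : Fin n → ℕ} → Mono c → Mono c → Set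
_∣ᵐ_ {n} v u = (i : Fin n) → toℕ (v i) ≤ toℕ (u i)

-- A set of c-monomials is a Boolean-valued predicate (c-monomials form a
-- finite set).
MonoSet : ∀ {n} → (Fin n → ℕ) → Set
MonoSet c = Mono c → Bool

IsMulticomplex : ∀ {n} (c : Fin n → ℕ) → MonoSet c → Set
IsMulticomplex c M =
  (∃ λ (a : Mono c) → M a ≡ true) ×
  (∀ (u v : Mono c) → M u ≡ true → v ∣ᵐ u → M v ≡ true)

IsProper : ∀ {n} (c : Fin n → ℕ) → MonoSet c → Set
IsProper c M = ∃ λ (a : Mono c) → M a ≡ false

-- The vertex set X̃ = ⋃ X̃ᵢ, X̃ᵢ = {xᵢ^(0),…,xᵢ^(cᵢ)}: xᵢ^(j) is (i , j).

Vert : ∀ {n} → (Fin n → ℕ) → Set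
Vert {n} c = Σ[ i ∈ Fin n ] Fin (suc (c i))

-- enumeration of X̃ (each vertex exactly once)
enumVert : ∀ {n} (c : Fin n → ℕ) → List (Vert c)
enumVert {n} c = concatMap (λ i → map (λ j → (i , j)) (allFin (suc (c i)))) (allFin n)

Face : ∀ {n} → (Fin n → ℕ) → Set
Face c = Vert c → Bool

countTrue : List Bool → ℕ
countTrue []          = 0
countTrue (true ∷ bs)  = suc (countTrue bs)
countTrue (false ∷ bs) = countTrue bs

card : ∀ {n} {c : Fin n → ℕ} → Face c → ℕ
card {c = c} σ = countTrue (map σ (enumVert c))

_⊆_ : ∀ {n} {c : Fin n → ℕ} → Face c → Face c → Set
σ ⊆ τ = ∀ v → σ v ≡ true → τ v ≡ true

_≐_ : ∀ {n} {c : Fin n → ℕ} → Face c → Face c → Set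
σ ≐ τ = ∀ v → σ v ≡ τ v

Complex : ∀ {n} → (Fin n → ℕ) → Set₁
Complex c = Face c → Set

⟨_⟩ : ∀ {n} {c : Fin n → ℕ} → List (Face c) → Complex c
⟨ Gs ⟩ σ = Any (λ G → σ ⊆ G) Gs

IsFacet : ∀ {n} {c : Fin n → ℕ} → Complex c → Face c → Set
IsFacet Δ F = Δ F × (∀ G → Δ G → F ⊆ G → G ⊆ F)

Fc : ∀ {n} {c : Fin n → ℕ} → Mono c → Face c
Fc a (i , j) = not ⌊ j ≟ a i ⌋

Bc : ∀ {n} (c : Fin n → ℕ) → MonoSet c → Complex c
Bc c M σ = ∃ λ (a : Mono c) → M a ≡ true × σ ⊆ Fc a

InExactlyOneFacet : ∀ {n} {c : Fin n → ℕ} → Complex c → Face c → Set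
InExactlyOneFacet B τ =
  Σ[ F ∈ _ ] (IsFacet B F × τ ⊆ F × (∀ G → IsFacet B G → τ ⊆ G → G ≐ F))

Boundary : ∀ {n} {c : Fin n → ℕ} → ℕ → Complex c → Complex c
Boundary d B σ =
  Σ[ τ ∈ _ ] (σ ⊆ τ × B τ × card τ + 1 ≡ d × InExactlyOneFacet B τ)

-- Bier sphere: B_c(M) is pure of dimension |c| - 1 (its facets are the
-- F_c(x^a), each with |c| elements), so d = |c|.
Bier : ∀ {n} (c : Fin n → ℕ) → MonoSet c → Complex c
Bier c M = Boundary ∣ c ∣ᶜ (Bc c M)

_⇔_ : Set → Set → Set
A ⇔ B = (A → B) × (B → A)

IsPure : ∀ {n} {c : Fin n → ℕ} → ℕ → Complex c → Set
IsPure d Δ =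
  (∀ σ → Δ σ → Σ[ F ∈ _ ] (IsFacet Δ F × σ ⊆ F)) ×
  (∀ F → IsFacet Δ F → card F ≡ d)

IsFacetOrder : ∀ {n} {c : Fin n → ℕ} → Complex c → List (Face c) → Set
IsFacetOrder Δ Fs =
  All (IsFacet Δ) Fs ×
  (∀ F → IsFacet Δ F → Any (λ G → F ≐ G) Fs) ×
  AllPairs (λ F G → ¬ (F ≐ G)) Fs

GeneratedByRidges : ∀ {n} {c : Fin n → ℕ} → ℕ → Face c → Complex c → Set
GeneratedByRidges d F K =
  Σ[ Gs ∈ List _ ] (All (λ G → G ⊆ F × card G + 1 ≡ d) Gs ×
                    (∀ σ → K σ ⇔ ⟨ Gs ⟩ σ))

IsShelling : ∀ {n} {c : Fin n → ℕ} → ℕ → List (Face c) → Set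
IsShelling d Fs =
  (i : Fin (length Fs)) → 1 ≤ toℕ i →
  GeneratedByRidges d (lookup Fs i)
    (λ σ → ⟨ take (toℕ i) Fs ⟩ σ × ⟨ lookup Fs i ∷ [] ⟩ σ)

IsShellable : ∀ {n} {c : Fin n → ℕ} → Complex c → Set
IsShellable Δ =
  Σ[ d ∈ ℕ ] (IsPure d Δ ×
    Σ[ Fs ∈ List _ ] (IsFacetOrder Δ Fs × IsShelling d Fs))

module Submission where

-- A move (a , i , j) replaces the exponent aᵢ of a c-monomial x^a by j; it
-- is an exit of M if x^a ∈ M but x^(a[i≔j]) ∉ M, and then aᵢ < j because M
-- is closed under divisors.  Its ridge is F(a) ∩ F(a[i≔j]) = F(a) ∖ x_i^(j).
--
--  * The facets of B_c(M) are the F(a), a ∈ M, all with |c| vertices.  A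
--    face with |c| - 1 vertices lying in exactly one facet F(a) is the
--    ridge of an exit from a, so the facets of Bier_c(M) are exactly the
--    exit ridges (module BierFacets).
--  * Moves are ranked lexicographically (rank); an increasing move is
--    determined by its ridge, so distinct exits of the same rank do not occur.
--  * Exchange lemma: if g is ranked before f, some vertex v of ridge f is
--    missing from ridge g, and ridge f ∖ v lies in the ridge of an exit
--    ranked before f (induction on n, slicing M along the exponent of x₁).
--  * A general criterion (shelling-criterion) turns the exchange lemma into
--    a shelling of the exit ridges listed by increasing rank.

open import Defs
open import Data.Empty using (⊥)
open import Data.Nat using (ℕ; zero; suc; _+_; _∸_; _≤_; _<_; z≤n; s≤s)
import Data.Nat.Properties as ℕ
open import Data.Fin using (Fin; _≟_; toℕ)
import Data.Fin as Fin
open import Data.Fin.Properties using (suc-injective; toℕ-injective; toℕ≤pred[n]; ¬∀⟶∃¬; <⇒≢)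
open import Data.Bool using (Bool; true; false; not; _∧_)
import Data.Bool.Properties as Bool
open import Data.Bool.Properties using (∧-conicalˡ; ∧-conicalʳ; ∧-zeroʳ; ∧-identityʳ; ∧-idem; not-injective)
open import Data.Product using (Σ; Σ-syntax; _×_; _,_; proj₁; proj₂)
import Data.Product.Properties as Product
open import Data.Sum using (_⊎_; inj₁; inj₂)
import Data.Sum as Sum
open import Data.List
  using (List; []; _∷_; map; foldr; filter; allFin; tabulate; _++_; length; concatMap; take; lookup)
open import Data.List.Properties
  using (map-++; map-∘; map-tabulate; tabulate-cong; map-cong; length-tabulate;
         concatMap-map; concatMap-cong; map-concatMap; ∷-injectiveˡ; ∷-injectiveʳ)
open import Data.List.Relation.Unary.All as All using (All; []; _∷_)
import Data.List.Relation.Unary.All.Properties as AllP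
open import Data.List.Relation.Unary.Any as Any using (Any; here; there)
import Data.List.Relation.Unary.Any.Properties as AnyP
open import Data.List.Relation.Unary.AllPairs using (AllPairs; []; _∷_)
import Data.List.Relation.Unary.AllPairs.Properties as APP
open import Data.List.Membership.Propositional using (_∈_; find; lose)
open import Data.List.Membership.Propositional.Properties
  using (∈-++⁺ʳ; ∈-++⁺ˡ; ∈-allFin; ∈-filter⁺; ∈-filter⁻)
open import Data.List.Relation.Binary.Lex.Strict using (Lex-<; base; this; next)
import Data.List.Relation.Binary.Lex.Strict as Lex
open import Data.List.Relation.Binary.Pointwise using (Pointwise-≡⇒≡; ≡⇒Pointwise-≡)
open import Function using (_∘_; id)
open import Relation.Binary.Definitions
  using (DecidableEquality; Trichotomous; Transitive; tri<; tri≈; tri>)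
open import Relation.Binary.PropositionalEquality
open import Relation.Nullary using (¬_; Dec; yes; no; contradiction)
open import Relation.Nullary.Decidable using (⌊_⌋; _×-dec_)

module _ {A : Set} where

  ⌊⌋-yes : (d : Dec A) → A → ⌊ d ⌋ ≡ true
  ⌊⌋-yes (yes _) _ = refl
  ⌊⌋-yes (no ¬a) a = contradiction a ¬a

  ⌊⌋-no : (d : Dec A) → ¬ A → ⌊ d ⌋ ≡ false
  ⌊⌋-no (yes a) ¬a = contradiction a ¬a
  ⌊⌋-no (no _)  _  = refl

  ⌊⌋-true : (d : Dec A) → ⌊ d ⌋ ≡ true → A
  ⌊⌋-true (yes a) _ = a

  ⌊⌋-false : (d : Dec A) → ⌊ d ⌋ ≡ false → ¬ A
  ⌊⌋-false (no ¬a) _ = ¬a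

⌊⌋-cong : ∀ {A B : Set} (d : Dec A) (e : Dec B) → (A → B) → (B → A) → ⌊ d ⌋ ≡ ⌊ e ⌋
⌊⌋-cong (yes a) e to from = sym (⌊⌋-yes e (to a))
⌊⌋-cong (no ¬a) e to from = sym (⌊⌋-no e (¬a ∘ from))

∧-intro : ∀ {x y} → x ≡ true → y ≡ true → x ∧ y ≡ true
∧-intro refl refl = refl

bool-clash : ∀ {b} → b ≡ true → b ≡ false → ⊥
bool-clash refl ()

module _ {n} {c : Fin n → ℕ} where

  infixl 30 _∖_

  _≟ᵛ_ : DecidableEquality (Vert c)
  _≟ᵛ_ = Product.≡-dec _≟_ _≟_

  _∖_ : Face c → Vert c → Face c
  (σ ∖ v) w = σ w ∧ not ⌊ w ≟ᵛ v ⌋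

  ∖-⊆ : ∀ {σ v} → σ ∖ v ⊆ σ
  ∖-⊆ w e = ∧-conicalˡ _ _ e

  ∖-avoids : ∀ {σ v w} → (σ ∖ v) w ≡ true → w ≢ v
  ∖-avoids {v = v} {w} e = ⌊⌋-false (w ≟ᵛ v) (not-injective (∧-conicalʳ _ _ e))

  ∖-self : ∀ {σ v} → (σ ∖ v) v ≡ false
  ∖-self {σ} {v} = trans (cong (λ b → σ v ∧ not b) (⌊⌋-yes (v ≟ᵛ v) refl)) (∧-zeroʳ (σ v))

  ∖-intro : ∀ {σ v w} → σ w ≡ true → w ≢ v → (σ ∖ v) w ≡ true
  ∖-intro {v = v} {w} σw w≢v = ∧-intro σw (cong not (⌊⌋-no (w ≟ᵛ v) w≢v))

  ∖-⊆-intro : ∀ {σ τ v} → (∀ w → σ w ≡ true → w ≢ v → τ w ≡ true) → σ ∖ v ⊆ τ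
  ∖-⊆-intro {σ} {v = v} h w e = h w (∖-⊆ {σ} {v} w e) (∖-avoids {σ} {v} e)

  ⊆-∖-intro : ∀ {σ τ v} → σ ⊆ τ → ¬ σ v ≡ true → σ ⊆ τ ∖ v
  ⊆-∖-intro {v = v} σ⊆τ v∉σ w σw =
    ∧-intro (σ⊆τ w σw) (cong not (⌊⌋-no (w ≟ᵛ v) λ { refl → v∉σ σw }))

  ⊆-omits : ∀ {σ τ : Face c} {w} → σ ⊆ τ → τ w ≡ false → σ w ≡ false
  ⊆-omits {σ} {w = w} σ⊆τ τw with σ w in σw
  ... | true  = contradiction (σ⊆τ w σw) (λ p → bool-clash p τw)
  ... | false = refl

  ⊆-trans : ∀ {σ τ ρ : Face c} → σ ⊆ τ → τ ⊆ ρ → σ ⊆ ρ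
  ⊆-trans s t w p = t w (s w p)

  ≐⇒⊆ : ∀ {σ τ : Face c} → σ ≐ τ → σ ⊆ τ
  ≐⇒⊆ e w p = trans (sym (e w)) p

  ⊆-antisym : ∀ {σ τ : Face c} → σ ⊆ τ → τ ⊆ σ → σ ≐ τ
  ⊆-antisym {σ} {τ} s t w with σ w in e1 | τ w in e2
  ... | true  | true  = refl
  ... | false | false = refl
  ... | true  | false = contradiction (s w e1) (λ p → bool-clash p e2)
  ... | false | true  = contradiction (t w e2) (λ p → bool-clash p e1)

count : ∀ {A : Set} → (A → Bool) → List A → ℕ
count f xs = countTrue (map f xs)

count-++ : ∀ {A : Set} (f : A → Bool) xs ys → count f (xs ++ ys) ≡ count f xs + count f ys
count-++ f xs ys = trans (cong countTrue (map-++ f xs ys)) (go (map f xs))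
  where
  go : ∀ bs → countTrue (bs ++ map f ys) ≡ countTrue bs + count f ys
  go []           = refl
  go (true ∷ bs)  = cong suc (go bs)
  go (false ∷ bs) = go bs

count-false : ∀ {A : Set} (xs : List A) → count (λ _ → false) xs ≡ 0
count-false []       = refl
count-false (x ∷ xs) = count-false xs

count-true : ∀ {A : Set} (xs : List A) → count (λ _ → true) xs ≡ length xs
count-true []       = refl
count-true (x ∷ xs) = cong suc (count-true xs)

count-split : ∀ {A : Set} (f p : A → Bool) xs →
  count f xs ≡ count (λ x → f x ∧ not (p x)) xs + count (λ x → f x ∧ p x) xs
count-split f p [] = refl
count-split f p (x ∷ xs) with f x | p x
... | false | _     = count-split f p xs
... | true  | false = cong suc (count-split f p xs)
... | true  | true  = trans (cong suc (count-split f p xs)) (sym (ℕ.+-suc _ _))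

count-mono : ∀ {A : Set} (f g : A → Bool) xs → (∀ x → f x ≡ true → g x ≡ true) →
  count f xs ≤ count g xs
count-mono f g [] h = z≤n
count-mono f g (x ∷ xs) h with f x in fx | g x in gx
... | true  | true  = s≤s (count-mono f g xs h)
... | true  | false = contradiction (h x fx) (λ p → bool-clash p gx)
... | false | true  = ℕ.m≤n⇒m≤1+n (count-mono f g xs h)
... | false | false = count-mono f g xs h

count-gap : ∀ {A : Set} (f g : A → Bool) xs → (∀ x → f x ≡ true → g x ≡ true) →
  count f xs < count g xs → Σ A λ x → g x ≡ true × f x ≡ false
count-gap f g [] h ()
count-gap f g (x ∷ xs) h lt with f x in fx | g x in gx
... | true  | true  = count-gap f g xs h (ℕ.≤-pred lt)
... | true  | false = contradiction (h x fx) (λ p → bool-clash p gx)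
... | false | true  = x , gx , fx
... | false | false = count-gap f g xs h lt

count-point : ∀ m (x : Fin (suc m)) → count (λ y → ⌊ y ≟ x ⌋) (allFin (suc m)) ≡ 1
count-point m x = trans (cong countTrue (map-tabulate {n = suc m} id (λ y → ⌊ y ≟ x ⌋))) (go m x)
  where
  go : ∀ m (x : Fin (suc m)) → countTrue (tabulate {n = suc m} (λ y → ⌊ y ≟ x ⌋)) ≡ 1
  go m Fin.zero = cong suc (trans (sym (cong countTrue (map-tabulate {n = m} id (λ _ → false))))
                                  (count-false (allFin m)))
  go (suc m) (Fin.suc x) =
    trans (cong countTrue (tabulate-cong λ y → ⌊⌋-cong (Fin.suc y ≟ Fin.suc x) (y ≟ x)
                                                  suc-injective (cong Fin.suc)))
          (go m x)

count-copoint : ∀ m (x : Fin (suc m)) → count (λ y → not ⌊ y ≟ x ⌋) (allFin (suc m)) ≡ m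
count-copoint m x = ℕ.suc-injective (begin
    suc (count (λ y → not ⌊ y ≟ x ⌋) (allFin (suc m)))
  ≡⟨ ℕ.+-comm 1 _ ⟩
    count (λ y → not ⌊ y ≟ x ⌋) (allFin (suc m)) + 1
  ≡⟨ cong (count (λ y → not ⌊ y ≟ x ⌋) (allFin (suc m)) +_) (sym (count-point m x)) ⟩
    count (λ y → not ⌊ y ≟ x ⌋) (allFin (suc m)) + count (λ y → ⌊ y ≟ x ⌋) (allFin (suc m))
  ≡⟨ sym (count-split (λ _ → true) (λ y → ⌊ y ≟ x ⌋) (allFin (suc m))) ⟩
    count (λ _ → true) (allFin (suc m))
  ≡⟨ trans (count-true (allFin (suc m))) (length-tabulate id) ⟩
    suc m
  ∎)
  where open ≡-Reasoning

lift : ∀ {n} {c : Fin (suc n) → ℕ} → Vert (c ∘ Fin.suc) → Vert c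
lift (i , j) = Fin.suc i , j

lift-injective : ∀ {n} {c : Fin (suc n) → ℕ} {v w : Vert (c ∘ Fin.suc)} → lift {c = c} v ≡ lift w → v ≡ w
lift-injective refl = refl

enumVert-suc : ∀ {n} (c : Fin (suc n) → ℕ) →
  enumVert c ≡ map (Fin.zero ,_) (allFin (suc (c Fin.zero))) ++ map lift (enumVert (c ∘ Fin.suc))
enumVert-suc {n} c = cong (map (Fin.zero ,_) (allFin (suc (c Fin.zero))) ++_) (begin
    concatMap block (tabulate Fin.suc)
  ≡⟨ cong (concatMap block) (sym (map-tabulate id Fin.suc)) ⟩
    concatMap block (map Fin.suc (allFin n))
  ≡⟨ concatMap-map block Fin.suc (allFin n) ⟩
    concatMap (block ∘ Fin.suc) (allFin n)
  ≡⟨ concatMap-cong (λ i → map-∘ (allFin (suc (c (Fin.suc i))))) (allFin n) ⟩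
    concatMap (map lift ∘ block′) (allFin n)
  ≡⟨ sym (map-concatMap lift block′ (allFin n)) ⟩
    map lift (enumVert (c ∘ Fin.suc))
  ∎)
  where
  open ≡-Reasoning
  block : (i : Fin (suc n)) → List (Vert c)
  block i = map (i ,_) (allFin (suc (c i)))
  block′ : (i : Fin n) → List (Vert (c ∘ Fin.suc))
  block′ i = map (i ,_) (allFin (suc (c (Fin.suc i))))

card-suc : ∀ {n} {c : Fin (suc n) → ℕ} (σ : Face c) →
  card σ ≡ count (λ j → σ (Fin.zero , j)) (allFin (suc (c Fin.zero))) + card (σ ∘ lift)
card-suc {n} {c} σ = begin
    count σ (enumVert c)
  ≡⟨ cong (count σ) (enumVert-suc c) ⟩
    count σ (map (Fin.zero ,_) (allFin (suc (c Fin.zero))) ++ map lift (enumVert (c ∘ Fin.suc)))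
  ≡⟨ count-++ σ (map (Fin.zero ,_) (allFin (suc (c Fin.zero)))) _ ⟩
    count σ (map (Fin.zero ,_) (allFin (suc (c Fin.zero)))) + count σ (map lift (enumVert (c ∘ Fin.suc)))
  ≡⟨ cong₂ _+_ (cong countTrue (sym (map-∘ {g = σ} {f = Fin.zero ,_} (allFin (suc (c Fin.zero))))))
               (cong countTrue (sym (map-∘ {g = σ} {f = lift} (enumVert (c ∘ Fin.suc))))) ⟩
    count (λ j → σ (Fin.zero , j)) (allFin (suc (c Fin.zero))) + card (σ ∘ lift)
  ∎
  where open ≡-Reasoning

-- |F_c(x^a)| = |c|: the facet omits exactly one vertex of every X̃ᵢ
card-Fc : ∀ {n} {c : Fin n → ℕ} (a : Mono c) → card (Fc a) ≡ ∣ c ∣ᶜ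
card-Fc {zero}  a = refl
card-Fc {suc n} {c} a =
  trans (card-suc (Fc a)) (cong₂ _+_ (count-copoint (c Fin.zero) (a Fin.zero)) (card-Fc (a ∘ Fin.suc)))

card-singleton : ∀ {n} {c : Fin n → ℕ} (v : Vert c) → card (λ w → ⌊ w ≟ᵛ v ⌋) ≡ 1
card-singleton {suc n} {c} (Fin.zero , x) =
  trans (card-suc {c = c} (λ w → ⌊ w ≟ᵛ (Fin.zero , x) ⌋))
        (cong₂ _+_ (trans (cong countTrue (map-cong zero-≟ (allFin (suc (c Fin.zero)))))
                          (count-point (c Fin.zero) x))
                   (count-false (enumVert (c ∘ Fin.suc))))
  where
  zero-≟ : ∀ y → ⌊ (Fin.zero , y) ≟ᵛ (Fin.zero , x) ⌋ ≡ ⌊ y ≟ x ⌋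
  zero-≟ y = ⌊⌋-cong ((Fin.zero , y) ≟ᵛ (Fin.zero , x)) (y ≟ x) (λ { refl → refl }) (cong (Fin.zero ,_))
card-singleton {suc n} {c} (Fin.suc k , x) =
  trans (card-suc {c = c} (λ w → ⌊ w ≟ᵛ (Fin.suc k , x) ⌋))
        (cong₂ _+_ (count-false (allFin (suc (c Fin.zero))))
                   (trans (cong countTrue (map-cong lift-≟ (enumVert (c ∘ Fin.suc))))
                          (card-singleton (k , x))))
  where
  lift-≟ : ∀ w → ⌊ lift w ≟ᵛ lift (k , x) ⌋ ≡ ⌊ w ≟ᵛ (k , x) ⌋
  lift-≟ w = ⌊⌋-cong (lift w ≟ᵛ lift (k , x)) (w ≟ᵛ (k , x)) lift-injective (cong lift)

module _ {n} {c : Fin n → ℕ} where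

  card-≐ : {σ τ : Face c} → σ ≐ τ → card σ ≡ card τ
  card-≐ σ≐τ = cong countTrue (map-cong σ≐τ (enumVert c))

  card-mono : {σ τ : Face c} → σ ⊆ τ → card σ ≤ card τ
  card-mono {σ} {τ} = count-mono σ τ (enumVert c)

  card-∖ : (σ : Face c) (v : Vert c) → σ v ≡ true → card σ ≡ suc (card (σ ∖ v))
  card-∖ σ v σv = begin
      card σ
    ≡⟨ count-split σ (λ w → ⌊ w ≟ᵛ v ⌋) (enumVert c) ⟩
      card (σ ∖ v) + card (λ w → σ w ∧ ⌊ w ≟ᵛ v ⌋)
    ≡⟨ cong (card (σ ∖ v) +_) (trans (cong countTrue (map-cong at-v (enumVert c))) (card-singleton v)) ⟩
      card (σ ∖ v) + 1
    ≡⟨ ℕ.+-comm _ 1 ⟩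
      suc (card (σ ∖ v))
    ∎
    where
    open ≡-Reasoning
    at-v : ∀ w → (σ w ∧ ⌊ w ≟ᵛ v ⌋) ≡ ⌊ w ≟ᵛ v ⌋
    at-v w with w ≟ᵛ v
    ... | yes refl = trans (∧-identityʳ (σ w)) σv
    ... | no _     = ∧-zeroʳ (σ w)

  card-gap : {σ τ : Face c} → σ ⊆ τ → card σ < card τ → Σ (Vert c) λ w → τ w ≡ true × σ w ≡ false
  card-gap {σ} {τ} = count-gap σ τ (enumVert c)

  card-⊆-≡ : {σ τ : Face c} → σ ⊆ τ → card σ ≡ card τ → τ ⊆ σ
  card-⊆-≡ {σ} {τ} σ⊆τ same w τw with σ w in σw
  ... | true  = refl
  ... | false = contradiction same (ℕ.<⇒≢ (begin-strict
      card σ        ≤⟨ card-mono (⊆-∖-intro σ⊆τ (λ p → bool-clash p σw)) ⟩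
      card (τ ∖ w)  <⟨ ℕ.n<1+n _ ⟩
      suc (card (τ ∖ w)) ≡⟨ sym (card-∖ τ w τw) ⟩
      card τ        ∎))
    where open ℕ.≤-Reasoning

module _ {n} {c : Fin n → ℕ} where

  Exchange : List (Face c) → Face c → Face c → Set
  Exchange earlier F G = Σ (Vert c) λ v → F v ≡ true × G v ≡ false × ⟨ earlier ⟩ (F ∖ v)

  exchange-generates : ∀ d earlier (F : Face c) → card F ≡ d → All (Exchange earlier F) earlier →
    GeneratedByRidges d F (λ σ → ⟨ earlier ⟩ σ × ⟨ F ∷ [] ⟩ σ)
  exchange-generates d earlier F cardF W =
    All.reduce generator W , ridges W , λ σ → (λ { (σ⊆G , here σ⊆F) → to W σ⊆G σ⊆F }) , from W
    where
    generator : ∀ {G} → Exchange earlier F G → Face c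
    generator (v , _) = F ∖ v

    ridges : ∀ {Gs} (W : All (Exchange earlier F) Gs) →
      All (λ H → H ⊆ F × card H + 1 ≡ d) (All.reduce generator W)
    ridges []                  = []
    ridges ((v , Fv , _) ∷ W) =
      (∖-⊆ {σ = F} {v = v} , trans (ℕ.+-comm _ 1) (trans (sym (card-∖ F v Fv)) cardF)) ∷ ridges W

    to : ∀ {Gs σ} (W : All (Exchange earlier F) Gs) → ⟨ Gs ⟩ σ → σ ⊆ F →
      ⟨ All.reduce generator W ⟩ σ
    to ((v , _ , Gv , _) ∷ W) (here σ⊆G) σ⊆F =
      here (⊆-∖-intro σ⊆F (λ σv → bool-clash (σ⊆G v σv) Gv))
    to (_ ∷ W) (there σ∈) σ⊆F = there (to W σ∈ σ⊆F)

    from : ∀ {Gs σ} (W : All (Exchange earlier F) Gs) → ⟨ All.reduce generator W ⟩ σ →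
      ⟨ earlier ⟩ σ × ⟨ F ∷ [] ⟩ σ
    from ((v , _ , _ , F∖v∈) ∷ W) (here σ⊆F∖v) =
      Any.map (⊆-trans σ⊆F∖v) F∖v∈ , here (⊆-trans σ⊆F∖v (∖-⊆ {σ = F} {v = v}))
    from (_ ∷ W) (there σ∈) = from W σ∈

split-at : ∀ {A B : Set} (Φ : A → B) (L : List A) (i : Fin (length (map Φ L))) →
  Σ (List A) λ pre → Σ A λ x → Σ (List A) λ post →
    L ≡ pre ++ x ∷ post × take (toℕ i) (map Φ L) ≡ map Φ pre × lookup (map Φ L) i ≡ Φ x
split-at Φ (x ∷ L) Fin.zero = [] , x , L , refl , refl , refl
split-at Φ (y ∷ L) (Fin.suc i) =
  let pre , x , post , L≡ , take≡ , lookup≡ = split-at Φ L i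
  in y ∷ pre , x , post , cong (y ∷_) L≡ , cong (Φ y ∷_) take≡ , lookup≡

shelling-criterion : ∀ {n} {c : Fin n → ℕ} {A : Set} (Φ : A → Face c) (L : List A) (d : ℕ) →
  All (λ x → card (Φ x) ≡ d) L →
  (∀ pre x post → L ≡ pre ++ x ∷ post → ∀ {g} → g ∈ pre → Exchange (map Φ pre) (Φ x) (Φ g)) →
  IsShelling d (map Φ L)
shelling-criterion Φ L d cards exchanges i _
  with pre , x , post , L≡ , take≡ , lookup≡ ← split-at Φ L i
  rewrite take≡ | lookup≡ =
  exchange-generates d (map Φ pre) (Φ x)
    (All.lookup cards (subst (x ∈_) (sym L≡) (∈-++⁺ʳ pre (here refl))))
    (AllP.map⁺ (All.tabulate (exchanges pre x post L≡)))

-- Strictly sorted lists: insertion sort by a key into a strict total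
-- order, keeping one element per key.

module SortByKey {A K : Set} (key : A → K) {_<_ : K → K → Set}
                 (compare : Trichotomous _≡_ _<_) (<-trans : Transitive _<_) where

  <-irrefl : ∀ {k} → ¬ k < k
  <-irrefl {k} k<k with compare k k
  ... | tri< _ k≢k _ = k≢k refl
  ... | tri≈ k≮k _ _ = k≮k k<k
  ... | tri> _ k≢k _ = k≢k refl

  Below : A → A → Set
  Below x y = key x < key y

  Sorted : List A → Set
  Sorted = AllPairs Below

  insert : A → List A → List A
  insert x [] = x ∷ []
  insert x (y ∷ ys) with compare (key x) (key y)
  ... | tri< _ _ _ = x ∷ y ∷ ys
  ... | tri≈ _ _ _ = y ∷ ys
  ... | tri> _ _ _ = y ∷ insert x ys

  sort : List A → List A
  sort = foldr insert []

  insert-⊆ : ∀ {z} x ys → z ∈ insert x ys → z ≡ x ⊎ z ∈ ys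
  insert-⊆ x [] (here z≡x) = inj₁ z≡x
  insert-⊆ x (y ∷ ys) z∈ with compare (key x) (key y) | z∈
  ... | tri< _ _ _ | here z≡x   = inj₁ z≡x
  ... | tri< _ _ _ | there z∈ys = inj₂ z∈ys
  ... | tri≈ _ _ _ | z∈ys       = inj₂ z∈ys
  ... | tri> _ _ _ | here z≡y   = inj₂ (here z≡y)
  ... | tri> _ _ _ | there z∈ with insert-⊆ x ys z∈
  ...   | inj₁ z≡x  = inj₁ z≡x
  ...   | inj₂ z∈ys = inj₂ (there z∈ys)

  sort-⊆ : ∀ {z} xs → z ∈ sort xs → z ∈ xs
  sort-⊆ (x ∷ xs) z∈ with insert-⊆ x (sort xs) z∈
  ... | inj₁ z≡x = here z≡x
  ... | inj₂ z∈s = there (sort-⊆ xs z∈s)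

  insert-has : ∀ x ys → Any (λ y → key y ≡ key x) (insert x ys)
  insert-has x [] = here refl
  insert-has x (y ∷ ys) with compare (key x) (key y)
  ... | tri< _ _ _    = here refl
  ... | tri≈ _ x≡y _  = here (sym x≡y)
  ... | tri> _ _ _    = there (insert-has x ys)

  insert-keeps : ∀ x ys {k} → Any (λ y → key y ≡ k) ys → Any (λ y → key y ≡ k) (insert x ys)
  insert-keeps x (y ∷ ys) has with compare (key x) (key y) | has
  ... | tri< _ _ _ | _          = there has
  ... | tri≈ _ _ _ | _          = has
  ... | tri> _ _ _ | here p     = here p
  ... | tri> _ _ _ | there has′ = there (insert-keeps x ys has′)

  sort-complete : ∀ {x} xs → x ∈ xs → Any (λ y → key y ≡ key x) (sort xs)
  sort-complete (x ∷ xs) (here refl) = insert-has x (sort xs)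
  sort-complete (y ∷ xs) (there x∈)  = insert-keeps y (sort xs) (sort-complete xs x∈)

  insert-above : ∀ {z} x ys → Below z x → All (Below z) ys → All (Below z) (insert x ys)
  insert-above x [] z<x [] = z<x ∷ []
  insert-above x (y ∷ ys) z<x (z<y ∷ z<ys) with compare (key x) (key y)
  ... | tri< _ _ _ = z<x ∷ z<y ∷ z<ys
  ... | tri≈ _ _ _ = z<y ∷ z<ys
  ... | tri> _ _ _ = z<y ∷ insert-above x ys z<x z<ys

  insert-sorted : ∀ x ys → Sorted ys → Sorted (insert x ys)
  insert-sorted x [] [] = [] ∷ []
  insert-sorted x (y ∷ ys) (y<ys ∷ sorted) with compare (key x) (key y)
  ... | tri< x<y _ _ = (x<y ∷ All.map (<-trans x<y) y<ys) ∷ y<ys ∷ sorted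
  ... | tri≈ _ _ _   = y<ys ∷ sorted
  ... | tri> _ _ y<x = insert-above x ys y<x y<ys ∷ insert-sorted x ys sorted

  sort-sorted : ∀ xs → Sorted (sort xs)
  sort-sorted []       = []
  sort-sorted (x ∷ xs) = insert-sorted x (sort xs) (sort-sorted xs)

  sorted-before : ∀ pre {x post g} → Sorted (pre ++ x ∷ post) → g ∈ pre → Below g x
  sorted-before (g ∷ pre) (g<rest ∷ _) (here refl) = All.lookup g<rest (∈-++⁺ʳ pre (here refl))
  sorted-before (_ ∷ pre) (_ ∷ sorted) (there g∈)  = sorted-before pre sorted g∈

  below-in-prefix : ∀ pre {x post y} → Sorted (pre ++ x ∷ post) → y ∈ pre ++ x ∷ post →
    Below y x → y ∈ pre
  below-in-prefix [] (_ ∷ _) (here refl) y<x = contradiction y<x <-irrefl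
  below-in-prefix [] (x<post ∷ _) (there y∈post) y<x =
    contradiction (<-trans (All.lookup x<post y∈post) y<x) <-irrefl
  below-in-prefix (z ∷ pre) _ (here refl) _ = here refl
  below-in-prefix (z ∷ pre) (_ ∷ sorted) (there y∈) y<x = there (below-in-prefix pre sorted y∈ y<x)

_<ᴸ_ : List ℕ → List ℕ → Set
_<ᴸ_ = Lex-< _≡_ _<_

<ᴸ-compare : Trichotomous _≡_ _<ᴸ_
<ᴸ-compare xs ys with Lex.<-compare sym ℕ.<-cmp xs ys
... | tri< lt ≉ gt = tri< lt (≉ ∘ ≡⇒Pointwise-≡) gt
... | tri≈ lt ≈ gt = tri≈ lt (Pointwise-≡⇒≡ ≈) gt
... | tri> lt ≉ gt = tri> lt (≉ ∘ ≡⇒Pointwise-≡) gt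

<ᴸ-trans : Transitive _<ᴸ_
<ᴸ-trans = Lex.<-transitive isEquivalence (resp₂ _<_) ℕ.<-trans

cons : ∀ {n} {c : Fin (suc n) → ℕ} → Fin (suc (c Fin.zero)) → Mono (c ∘ Fin.suc) → Mono c
cons t a Fin.zero    = t
cons t a (Fin.suc k) = a k

infixl 40 _[_≔_]
_[_≔_] : ∀ {n} {c : Fin n → ℕ} → Mono c → (i : Fin n) → Fin (suc (c i)) → Mono c
(a [ Fin.zero ≔ j ]) Fin.zero    = j
(a [ Fin.zero ≔ j ]) (Fin.suc k) = a (Fin.suc k)
(a [ Fin.suc i ≔ j ]) Fin.zero   = a Fin.zero
_[_≔_] {suc n} {c} a (Fin.suc i) j (Fin.suc k) = _[_≔_] {c = c ∘ Fin.suc} (a ∘ Fin.suc) i j k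

≔-same : ∀ {n} {c : Fin n → ℕ} (a : Mono c) i j → (a [ i ≔ j ]) i ≡ j
≔-same a Fin.zero    j = refl
≔-same a (Fin.suc i) j = ≔-same (a ∘ Fin.suc) i j

≔-other : ∀ {n} {c : Fin n → ℕ} (a : Mono c) i j k → k ≢ i → (a [ i ≔ j ]) k ≡ a k
≔-other a Fin.zero    j Fin.zero    k≢i = contradiction refl k≢i
≔-other a Fin.zero    j (Fin.suc k) _   = refl
≔-other a (Fin.suc i) j Fin.zero    _   = refl
≔-other a (Fin.suc i) j (Fin.suc k) k≢i = ≔-other (a ∘ Fin.suc) i j k (k≢i ∘ cong Fin.suc)

infix 4 _≈ᵐ_
_≈ᵐ_ : ∀ {n} {c : Fin n → ℕ} → Mono c → Mono c → Set
a ≈ᵐ b = ∀ k → a k ≡ b k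

≔-cong : ∀ {n} {c : Fin n → ℕ} {a b : Mono c} → a ≈ᵐ b → ∀ i j → a [ i ≔ j ] ≈ᵐ b [ i ≔ j ]
≔-cong {a = a} {b} a≈b i j k with k ≟ i
... | yes refl = trans (≔-same a k j) (sym (≔-same b k j))
... | no k≢i   = trans (≔-other a i j k k≢i) (trans (a≈b k) (sym (≔-other b i j k k≢i)))

≔-raises : ∀ {n} {c : Fin n → ℕ} (a : Mono c) i j → toℕ (a i) ≤ toℕ j → a ∣ᵐ a [ i ≔ j ]
≔-raises a i j ai≤j k with k ≟ i
... | yes refl = subst (λ t → toℕ (a k) ≤ toℕ t) (sym (≔-same a k j)) ai≤j
... | no k≢i   = ℕ.≤-reflexive (cong toℕ (sym (≔-other a i j k k≢i)))

≔-lowers : ∀ {n} {c : Fin n → ℕ} (a : Mono c) i j → toℕ j ≤ toℕ (a i) → a [ i ≔ j ] ∣ᵐ a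
≔-lowers a i j j≤ai k with k ≟ i
... | yes refl = subst (λ t → toℕ t ≤ toℕ (a k)) (sym (≔-same a k j)) j≤ai
... | no k≢i   = ℕ.≤-reflexive (cong toℕ (≔-other a i j k k≢i))

Move : ∀ {n} → (Fin n → ℕ) → Set
Move {n} c = Mono c × Σ[ i ∈ Fin n ] Fin (suc (c i))

module _ {n} {c : Fin n → ℕ} where

  target : Move c → Mono c
  target (a , i , j) = a [ i ≔ j ]

  Increasing : Move c → Set
  Increasing (a , i , j) = toℕ (a i) < toℕ j

  Exit : MonoSet c → Move c → Set
  Exit M x@(a , _) = M a ≡ true × M (target x) ≡ false

  ridge : Move c → Face c
  ridge x@(a , _) w = Fc a w ∧ Fc (target x) w

module _ {n} {c : Fin n → ℕ} where

  Fc-omits : ∀ (a : Mono c) k → Fc a (k , a k) ≡ false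
  Fc-omits a k = cong not (⌊⌋-yes (a k ≟ a k) refl)

  Fc-contains : ∀ (a : Mono c) k {y} → y ≢ a k → Fc a (k , y) ≡ true
  Fc-contains a k {y} y≢ak = cong not (⌊⌋-no (y ≟ a k) y≢ak)

  Fc-omitted : ∀ (a : Mono c) k {y} → Fc a (k , y) ≡ false → y ≡ a k
  Fc-omitted a k {y} e = ⌊⌋-true (y ≟ a k) (not-injective e)

  Fc-contained : ∀ (a : Mono c) k {y} → Fc a (k , y) ≡ true → y ≢ a k
  Fc-contained a k {y} e = ⌊⌋-false (y ≟ a k) (not-injective e)

  Fc-≈ : {a b : Mono c} → a ≈ᵐ b → Fc a ≐ Fc b
  Fc-≈ a≈b (k , y) = cong (λ t → not ⌊ y ≟ t ⌋) (a≈b k)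

  Fc-⊆⇒≈ : (a b : Mono c) → Fc a ⊆ Fc b → a ≈ᵐ b
  Fc-⊆⇒≈ a b Fa⊆Fb k with a k ≟ b k
  ... | yes ak≡bk = ak≡bk
  ... | no ak≢bk  =
    contradiction (Fa⊆Fb (k , b k) (Fc-contains a k (ak≢bk ∘ sym))) (λ p → bool-clash p (Fc-omits b k))

  Fc-≔-same : ∀ (a : Mono c) i j y → Fc (a [ i ≔ j ]) (i , y) ≡ not ⌊ y ≟ j ⌋
  Fc-≔-same a i j y = cong (λ t → not ⌊ y ≟ t ⌋) (≔-same a i j)

  Fc-≔-other : ∀ (a : Mono c) i j {k} y → k ≢ i → Fc (a [ i ≔ j ]) (k , y) ≡ Fc a (k , y)
  Fc-≔-other a i j {k} y k≢i = cong (λ t → not ⌊ y ≟ t ⌋) (≔-other a i j k k≢i)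

  ⊆-Fc-≔ : ∀ {τ} (a : Mono c) i j → τ ⊆ Fc a → τ (i , j) ≡ false → τ ⊆ Fc (a [ i ≔ j ])
  ⊆-Fc-≔ a i j τ⊆Fa τij (k , y) τw with k ≟ i
  ... | no k≢i   = trans (Fc-≔-other a i j y k≢i) (τ⊆Fa (k , y) τw)
  ... | yes refl = trans (Fc-≔-same a k j y) (cong not (⌊⌋-no (y ≟ j) λ { refl → bool-clash τw τij }))

  ridge-⊆-source : (x : Move c) → ridge x ⊆ Fc (proj₁ x)
  ridge-⊆-source x w e = ∧-conicalˡ _ _ e

  ridge-⊆-target : (x : Move c) → ridge x ⊆ Fc (target x)
  ridge-⊆-target x w e = ∧-conicalʳ _ _ e

  ridge-omits-source : ∀ (x : Move c) k → ridge x (k , proj₁ x k) ≡ false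
  ridge-omits-source (a , _) k rewrite Fc-omits a k = refl

  ridge-omits-target : ∀ (x : Move c) k → ridge x (k , target x k) ≡ false
  ridge-omits-target x@(a , _) k rewrite Fc-omits (target x) k = ∧-zeroʳ _

  ridge-omitted : ∀ (x : Move c) k {y} → ridge x (k , y) ≡ false → y ≡ proj₁ x k ⊎ y ≡ target x k
  ridge-omitted x@(a , _) k {y} e with Fc a (k , y) in Fa
  ... | false = inj₁ (Fc-omitted a k Fa)
  ... | true  = inj₂ (Fc-omitted (target x) k e)

  ridge-⊆-Fc-blockwise : ∀ (x : Move c) b → ridge x ⊆ Fc b →
    ∀ k → b k ≡ proj₁ x k ⊎ b k ≡ target x k
  ridge-⊆-Fc-blockwise x b R⊆Fb k = ridge-omitted x k (⊆-omits {σ = ridge x} R⊆Fb (Fc-omits b k))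

  ridge-⊆-Fc : ∀ (x : Move c) b → ridge x ⊆ Fc b → b ≈ᵐ proj₁ x ⊎ b ≈ᵐ target x
  ridge-⊆-Fc x@(a , i , j) b R⊆Fb with b i ≟ a i
  ... | yes bi≡ai = inj₁ λ k → source bi≡ai k (k ≟ i) (ridge-⊆-Fc-blockwise x b R⊆Fb k)
    where
    source : b i ≡ a i → ∀ k → Dec (k ≡ i) → b k ≡ a k ⊎ b k ≡ target x k → b k ≡ a k
    source bi≡ai k (yes refl) _        = bi≡ai
    source _     k (no _)     (inj₁ p) = p
    source _     k (no k≢i)   (inj₂ p) = trans p (≔-other a i j k k≢i)
  ... | no bi≢ai = inj₂ λ k → moved bi≢ai k (k ≟ i) (ridge-⊆-Fc-blockwise x b R⊆Fb k)
    where
    moved : b i ≢ a i → ∀ k → Dec (k ≡ i) → b k ≡ a k ⊎ b k ≡ target x k → b k ≡ target x k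
    moved bi≢ai k (yes refl) (inj₁ p) = contradiction p bi≢ai
    moved _     k _          (inj₂ p) = p
    moved _     k (no k≢i)   (inj₁ p) = trans p (sym (≔-other a i j k k≢i))

  ≟ᵛ-block : ∀ k (y j : Fin (suc (c k))) → ⌊ _≟ᵛ_ {c = c} (k , y) (k , j) ⌋ ≡ ⌊ y ≟ j ⌋
  ≟ᵛ-block k y j = ⌊⌋-cong (_≟ᵛ_ {c = c} (k , y) (k , j)) (y ≟ j) (λ { refl → refl }) (cong (k ,_))

  ridge-≐ : ∀ (a : Mono c) i j → ridge (a , i , j) ≐ Fc a ∖ (i , j)
  ridge-≐ a i j (k , y) = by-block (k ≟ i)
    where
    open ≡-Reasoning
    other-block : k ≢ i → ⌊ _≟ᵛ_ {c = c} (k , y) (i , j) ⌋ ≡ false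
    other-block k≢i = ⌊⌋-no (_≟ᵛ_ {c = c} (k , y) (i , j)) (k≢i ∘ cong proj₁)
    by-block : Dec (k ≡ i) → ridge (a , i , j) (k , y) ≡ (Fc a ∖ (i , j)) (k , y)
    by-block (yes refl) = cong (Fc a (k , y) ∧_) (trans (Fc-≔-same a k j y) (cong not (sym (≟ᵛ-block k y j))))
    by-block (no k≢i)   = begin
      Fc a (k , y) ∧ Fc (a [ i ≔ j ]) (k , y) ≡⟨ cong (Fc a (k , y) ∧_) (Fc-≔-other a i j y k≢i) ⟩
      Fc a (k , y) ∧ Fc a (k , y)             ≡⟨ ∧-idem (Fc a (k , y)) ⟩
      Fc a (k , y)                            ≡⟨ sym (∧-identityʳ _) ⟩
      Fc a (k , y) ∧ true                     ≡⟨ cong (λ b → Fc a (k , y) ∧ not b) (sym (other-block k≢i)) ⟩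
      (Fc a ∖ (i , j)) (k , y)                ∎

DownClosed : ∀ {n} {c : Fin n → ℕ} → MonoSet c → Set
DownClosed {c = c} M = ∀ (u v : Mono c) → M u ≡ true → v ∣ᵐ u → M v ≡ true

≈ᵐ⇒∣ᵐ : ∀ {n} {c : Fin n → ℕ} {u v : Mono c} → u ≈ᵐ v → u ∣ᵐ v
≈ᵐ⇒∣ᵐ u≈v k = ℕ.≤-reflexive (cong toℕ (u≈v k))

module _ {n} {c : Fin n → ℕ} {M : MonoSet c} (closed : DownClosed M) where

  member-≈ : {a b : Mono c} → a ≈ᵐ b → M a ≡ M b
  member-≈ {a} {b} a≈b with M a in Ma | M b in Mb
  ... | true  | true  = refl
  ... | false | false = refl
  ... | true  | false = contradiction (closed a b Ma (≈ᵐ⇒∣ᵐ (sym ∘ a≈b))) (λ p → bool-clash p Mb)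
  ... | false | true  = contradiction (closed b a Mb (≈ᵐ⇒∣ᵐ a≈b)) (λ p → bool-clash p Ma)

  lower-member : ∀ {a} k x → M a ≡ true → toℕ x ≤ toℕ (a k) → M (a [ k ≔ x ]) ≡ true
  lower-member {a} k x Ma x≤ak = closed a (a [ k ≔ x ]) Ma (≔-lowers a k x x≤ak)

  exit-increasing : ∀ (x : Move c) → Exit M x → Increasing x
  exit-increasing (a , i , j) (Ma , Mt) with toℕ (a i) ℕ.<? toℕ j
  ... | yes ai<j = ai<j
  ... | no ai≮j  = contradiction (lower-member i j Ma (ℕ.≮⇒≥ ai≮j)) (λ p → bool-clash p Mt)

  above-outside : ∀ {u v} → M u ≡ false → u ∣ᵐ v → M v ≡ false
  above-outside {u} {v} Mu u∣v with M v in Mv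
  ... | true  = contradiction (closed v u Mv u∣v) (λ p → bool-clash p Mu)
  ... | false = refl

  outside-exceeds : ∀ {a b} → M a ≡ true → M b ≡ false → Σ (Fin n) λ k → toℕ (a k) < toℕ (b k)
  outside-exceeds {a} {b} Ma Mb
    with k , b≰a ← ¬∀⟶∃¬ n (λ k → toℕ (b k) ≤ toℕ (a k)) (λ k → toℕ (b k) ℕ.≤? toℕ (a k))
                           (λ b∣a → bool-clash (closed a b Ma b∣a) Mb)
    = k , ℕ.≰⇒> b≰a

module BierFacets {n} {c : Fin n → ℕ} {M : MonoSet c} (closed : DownClosed M) where

  Fc-facet : ∀ {a} → M a ≡ true → IsFacet (Bc c M) (Fc a)
  Fc-facet {a} Ma = (a , Ma , (λ _ e → e)) , λ { G (b , Mb , G⊆Fb) Fa⊆G →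
    ⊆-trans G⊆Fb (≐⇒⊆ (Fc-≈ λ k → sym (Fc-⊆⇒≈ a b (⊆-trans Fa⊆G G⊆Fb) k))) }

  facet-Fc : ∀ {F} → IsFacet (Bc c M) F → Σ (Mono c) λ a → M a ≡ true × F ≐ Fc a
  facet-Fc ((a , Ma , F⊆Fa) , maximal) =
    a , Ma , ⊆-antisym F⊆Fa (maximal (Fc a) (a , Ma , λ _ e → e) F⊆Fa)

  -- an exit ridge is F(a) minus the vertex (i , j), so it has |c| - 1 vertices
  card-ridge : ∀ (x : Move c) → Exit M x → card (ridge x) + 1 ≡ ∣ c ∣ᶜ
  card-ridge x@(a , i , j) ex = begin
      card (ridge x) + 1         ≡⟨ ℕ.+-comm _ 1 ⟩
      suc (card (ridge x))       ≡⟨ cong suc (card-≐ (ridge-≐ a i j)) ⟩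
      suc (card (Fc a ∖ (i , j))) ≡⟨ sym (card-∖ (Fc a) (i , j) (Fc-contains a i j≢ai)) ⟩
      card (Fc a)                ≡⟨ card-Fc a ⟩
      ∣ c ∣ᶜ                     ∎
    where
    open ≡-Reasoning
    j≢ai : j ≢ a i
    j≢ai j≡ai = ℕ.<-irrefl (cong toℕ (sym j≡ai)) (exit-increasing closed x ex)

  ridge-in-one-facet : ∀ (x : Move c) → Exit M x → InExactlyOneFacet (Bc c M) (ridge x)
  ridge-in-one-facet x@(a , _) (Ma , Mt) = Fc a , Fc-facet Ma , ridge-⊆-source x , unique
    where
    unique : ∀ G → IsFacet (Bc c M) G → ridge x ⊆ G → G ≐ Fc a
    unique G G-facet R⊆G with b , Mb , G≐Fb ← facet-Fc G-facet
                         with ridge-⊆-Fc x b (⊆-trans R⊆G (≐⇒⊆ G≐Fb))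
    ... | inj₁ b≈a = λ w → trans (G≐Fb w) (Fc-≈ b≈a w)
    ... | inj₂ b≈t = contradiction (trans (sym (member-≈ closed b≈t)) Mb) (λ p → bool-clash p Mt)

  ridge-in-Bier : ∀ (x : Move c) → Exit M x → Bier c M (ridge x)
  ridge-in-Bier x@(a , _) ex@(Ma , _) =
    ridge x , (λ _ e → e) , (a , Ma , ridge-⊆-source x) , card-ridge x ex , ridge-in-one-facet x ex

  -- a subface τ of F(a) with |c| - 1 vertices, lying in no other facet,
  -- is the ridge of an exit from a: the vertex (i , z) of F(a) ∖ τ gives
  -- a[i≔z] ∉ M, as F(a[i≔z]) ⊇ τ differs from F(a)
  only-facet-ridge : ∀ a τ → M a ≡ true → τ ⊆ Fc a → card τ + 1 ≡ ∣ c ∣ᶜ →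
    (∀ b → M b ≡ true → τ ⊆ Fc b → b ≈ᵐ a) → Σ (Move c) λ x → Exit M x × τ ⊆ ridge x
  only-facet-ridge a τ Ma τ⊆Fa cardτ only
    with (i , z) , Fa-iz , τ-iz ←
           card-gap τ⊆Fa (ℕ.≤-reflexive (trans (ℕ.+-comm 1 _) (trans cardτ (sym (card-Fc a)))))
    = (a , i , z) , (Ma , leaves (M (a [ i ≔ z ])) refl) , λ w τw → ∧-intro (τ⊆Fa w τw) (τ⊆Ft w τw)
    where
    τ⊆Ft : τ ⊆ Fc (a [ i ≔ z ])
    τ⊆Ft = ⊆-Fc-≔ a i z τ⊆Fa τ-iz
    leaves : ∀ b → M (a [ i ≔ z ]) ≡ b → M (a [ i ≔ z ]) ≡ false
    leaves false Mt = Mt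
    leaves true  Mt = contradiction (trans (sym (≔-same a i z)) (only _ Mt τ⊆Ft i)) (Fc-contained a i Fa-iz)

  Bier-face-in-ridge : ∀ σ → Bier c M σ → Σ (Move c) λ x → Exit M x × σ ⊆ ridge x
  Bier-face-in-ridge σ (τ , σ⊆τ , _ , cardτ , F , F-facet , τ⊆F , unique)
    with a , Ma , F≐Fa ← facet-Fc F-facet
    with x , ex , τ⊆R ← only-facet-ridge a τ Ma (⊆-trans τ⊆F (≐⇒⊆ F≐Fa)) cardτ
           (λ b Mb τ⊆Fb → Fc-⊆⇒≈ b a (≐⇒⊆ λ w →
              trans (unique (Fc b) (Fc-facet Mb) τ⊆Fb w) (F≐Fa w)))
    = x , ex , ⊆-trans σ⊆τ τ⊆R

  -- exit ridges all have the same size, so none is strictly inside another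
  ridge-⊆-ridge : ∀ (x y : Move c) → Exit M x → Exit M y → ridge x ⊆ ridge y → ridge y ⊆ ridge x
  ridge-⊆-ridge x y ex ey R⊆R =
    card-⊆-≡ R⊆R (ℕ.+-cancelʳ-≡ _ _ _ (trans (card-ridge x ex) (sym (card-ridge y ey))))

  ridge-facet : ∀ (x : Move c) → Exit M x → IsFacet (Bier c M) (ridge x)
  ridge-facet x ex = ridge-in-Bier x ex , maximal
    where
    maximal : ∀ G → Bier c M G → ridge x ⊆ G → G ⊆ ridge x
    maximal G G∈ R⊆G with y , ey , G⊆R ← Bier-face-in-ridge G G∈ =
      ⊆-trans G⊆R (ridge-⊆-ridge x y ex ey (⊆-trans R⊆G G⊆R))

  facet-ridge : ∀ {F} → IsFacet (Bier c M) F → Σ (Move c) λ x → Exit M x × F ≐ ridge x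
  facet-ridge {F} (F∈ , maximal) with x , ex , F⊆R ← Bier-face-in-ridge F F∈ =
    x , ex , ⊆-antisym F⊆R (maximal (ridge x) (ridge-in-Bier x ex) F⊆R)

-- Ranking moves.  rank (a , i , j) compares a₁ first; among equal a₁,
-- moves of a later coordinate (tag 0) precede moves of x₁ (tag 1).  Moves
-- of x₁ are compared by j and then by the co-exponents cₖ - aₖ (so larger
-- exponents come first), moves of later coordinates recursively.

coexponents : ∀ {n} {c : Fin n → ℕ} → Mono c → List ℕ
coexponents {zero}      a = []
coexponents {suc n} {c} a = (c Fin.zero ∸ toℕ (a Fin.zero)) ∷ coexponents (a ∘ Fin.suc)

mutual
  rank : ∀ {n} {c : Fin n → ℕ} → Move c → List ℕ
  rank {zero}  (_ , () , _)
  rank {suc n} x@(a , _) = toℕ (a Fin.zero) ∷ rank-tail x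

  rank-tail : ∀ {n} {c : Fin (suc n) → ℕ} → Move c → List ℕ
  rank-tail (a , Fin.zero , j)  = 1 ∷ toℕ j ∷ coexponents (a ∘ Fin.suc)
  rank-tail (a , Fin.suc i , j) = 0 ∷ rank (a ∘ Fin.suc , i , j)

coexponents-≈ : ∀ {n} {c : Fin n → ℕ} {a b : Mono c} → a ≈ᵐ b → coexponents a ≡ coexponents b
coexponents-≈ {zero}  a≈b = refl
coexponents-≈ {suc n} {c} a≈b =
  cong₂ _∷_ (cong (λ t → c Fin.zero ∸ toℕ t) (a≈b Fin.zero)) (coexponents-≈ (a≈b ∘ Fin.suc))

coexponents-injective : ∀ {n} {c : Fin n → ℕ} (a b : Mono c) → coexponents a ≡ coexponents b → a ≈ᵐ b
coexponents-injective a b eq Fin.zero =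
  toℕ-injective (ℕ.∸-cancelˡ-≡ (toℕ≤pred[n] (a Fin.zero)) (toℕ≤pred[n] (b Fin.zero)) (∷-injectiveˡ eq))
coexponents-injective a b eq (Fin.suc k) =
  coexponents-injective (a ∘ Fin.suc) (b ∘ Fin.suc) (∷-injectiveʳ eq) k

coexponents-raise : ∀ {n} {c : Fin n → ℕ} (a : Mono c) k x → toℕ (a k) < toℕ x →
  coexponents (a [ k ≔ x ]) <ᴸ coexponents a
coexponents-raise a Fin.zero    x ak<x = this (ℕ.∸-monoʳ-< ak<x (toℕ≤pred[n] x))
coexponents-raise a (Fin.suc k) x ak<x = next refl (coexponents-raise (a ∘ Fin.suc) k x ak<x)

coexponents-< : ∀ {n} {c : Fin n → ℕ} (a b : Mono c) → coexponents b <ᴸ coexponents a →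
  Σ (Fin n) λ k → toℕ (a k) < toℕ (b k)
coexponents-< {zero} a b (base ())
coexponents-< {suc n} {c} a b (this lt) with toℕ (a Fin.zero) ℕ.<? toℕ (b Fin.zero)
... | yes ak<bk = Fin.zero , ak<bk
... | no ak≮bk  = contradiction (ℕ.∸-monoʳ-≤ (c Fin.zero) (ℕ.≮⇒≥ ak≮bk)) (ℕ.<⇒≱ lt)
coexponents-< {suc n} a b (next _ lt) with k , ak<bk ← coexponents-< (a ∘ Fin.suc) (b ∘ Fin.suc) lt =
  Fin.suc k , ak<bk

rank-≈ : ∀ {n} {c : Fin n → ℕ} {a b : Mono c} → a ≈ᵐ b → ∀ i j → rank (a , i , j) ≡ rank (b , i , j)
rank-≈ a≈b Fin.zero j =
  cong₂ _∷_ (cong toℕ (a≈b Fin.zero)) (cong (λ t → 1 ∷ toℕ j ∷ t) (coexponents-≈ (a≈b ∘ Fin.suc)))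
rank-≈ a≈b (Fin.suc i) j =
  cong₂ _∷_ (cong toℕ (a≈b Fin.zero)) (cong (0 ∷_) (rank-≈ (a≈b ∘ Fin.suc) i j))

rank-injective : ∀ {n} {c : Fin n → ℕ} (x y : Move c) → rank x ≡ rank y →
  proj₁ x ≈ᵐ proj₁ y × target x ≈ᵐ target y
rank-injective (a , Fin.zero , j) (b , Fin.zero , j′) eq = a≈b , t≈t
  where
  a≈b : a ≈ᵐ b
  a≈b Fin.zero    = toℕ-injective (∷-injectiveˡ eq)
  a≈b (Fin.suc k) =
    coexponents-injective (a ∘ Fin.suc) (b ∘ Fin.suc) (∷-injectiveʳ (∷-injectiveʳ (∷-injectiveʳ eq))) k
  t≈t : a [ Fin.zero ≔ j ] ≈ᵐ b [ Fin.zero ≔ j′ ]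
  t≈t Fin.zero    = toℕ-injective (∷-injectiveˡ (∷-injectiveʳ (∷-injectiveʳ eq)))
  t≈t (Fin.suc k) = a≈b (Fin.suc k)
rank-injective (a , Fin.zero , j)  (b , Fin.suc i′ , j′) eq = contradiction (∷-injectiveˡ (∷-injectiveʳ eq)) λ ()
rank-injective (a , Fin.suc i , j) (b , Fin.zero , j′)   eq = contradiction (∷-injectiveˡ (∷-injectiveʳ eq)) λ ()
rank-injective (a , Fin.suc i , j) (b , Fin.suc i′ , j′) eq
  with a≈b , t≈t ← rank-injective (a ∘ Fin.suc , i , j) (b ∘ Fin.suc , i′ , j′)
                                   (∷-injectiveʳ (∷-injectiveʳ eq)) =
  (λ { Fin.zero → a₁≡b₁ ; (Fin.suc k) → a≈b k }) ,
  (λ { Fin.zero → a₁≡b₁ ; (Fin.suc k) → t≈t k })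
  where
  a₁≡b₁ : a Fin.zero ≡ b Fin.zero
  a₁≡b₁ = toℕ-injective (∷-injectiveˡ eq)

module _ {n} {c : Fin n → ℕ} where

  ridge-≈ : ∀ (x y : Move c) → proj₁ x ≈ᵐ proj₁ y → target x ≈ᵐ target y → ridge x ≐ ridge y
  ridge-≈ x y a≈b t≈t w = cong₂ _∧_ (Fc-≈ a≈b w) (Fc-≈ t≈t w)

  rank-determines-ridge : ∀ (x y : Move c) → rank x ≡ rank y → ridge x ≐ ridge y
  rank-determines-ridge x y eq = let a≈b , t≈t = rank-injective x y eq in ridge-≈ x y a≈b t≈t

pair-≡ : ∀ {p q p′ q′ : ℕ} → p ≤ q → p′ ≤ q′ →
  p ≡ p′ ⊎ p ≡ q′ → q ≡ p′ ⊎ q ≡ q′ → p′ ≡ p ⊎ p′ ≡ q → q′ ≡ p ⊎ q′ ≡ q →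
  p ≡ p′ × q ≡ q′
pair-≡ {p} {q} {p′} {q′} p≤q p′≤q′ p∈ q∈ p′∈ q′∈ =
  min p∈ p′∈ , max (min p∈ p′∈) q∈ q′∈
  where
  min : p ≡ p′ ⊎ p ≡ q′ → p′ ≡ p ⊎ p′ ≡ q → p ≡ p′
  min (inj₁ e)    _           = e
  min (inj₂ _)    (inj₁ e)    = sym e
  min (inj₂ refl) (inj₂ refl) = ℕ.≤-antisym p≤q p′≤q′
  max : p ≡ p′ → q ≡ p′ ⊎ q ≡ q′ → q′ ≡ p ⊎ q′ ≡ q → q ≡ q′
  max _    (inj₂ e)    _           = e
  max _    (inj₁ _)    (inj₂ e)    = sym e
  max refl (inj₁ refl) (inj₁ refl) = refl

module _ {n} {c : Fin n → ℕ} where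

  -- the ridge of an increasing move determines its source and target: in
  -- each block X̃ₖ it omits exactly the vertices with indices aₖ ≤ (a[i≔j])ₖ
  ridge-injective : ∀ (x y : Move c) → Increasing x → Increasing y → ridge x ≐ ridge y →
    proj₁ x ≈ᵐ proj₁ y × target x ≈ᵐ target y
  ridge-injective x@(a , _) y@(b , _) x↑ y↑ R≐R = (λ k → proj₁ (block k)) , (λ k → proj₂ (block k))
    where
    in-y : ∀ k {v} → ridge x (k , v) ≡ false → toℕ v ≡ toℕ (b k) ⊎ toℕ v ≡ toℕ (target y k)
    in-y k {v} e = Sum.map (cong toℕ) (cong toℕ) (ridge-omitted y k (trans (sym (R≐R (k , v))) e))
    in-x : ∀ k {v} → ridge y (k , v) ≡ false → toℕ v ≡ toℕ (a k) ⊎ toℕ v ≡ toℕ (target x k)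
    in-x k {v} e = Sum.map (cong toℕ) (cong toℕ) (ridge-omitted x k (trans (R≐R (k , v)) e))
    block : ∀ k → a k ≡ b k × target x k ≡ target y k
    block k =
      let ak≡bk , tk≡t′k = pair-≡ (≔-raises a _ _ (ℕ.<⇒≤ x↑) k) (≔-raises b _ _ (ℕ.<⇒≤ y↑) k)
            (in-y k (ridge-omits-source x k)) (in-y k (ridge-omits-target x k))
            (in-x k (ridge-omits-source y k)) (in-x k (ridge-omits-target y k))
      in toℕ-injective ak≡bk , toℕ-injective tk≡t′k

  ridge-determines-rank : ∀ (x y : Move c) → Increasing x → Increasing y → ridge x ≐ ridge y →
    rank x ≡ rank y
  ridge-determines-rank x@(a , i , j) y@(b , i′ , j′) x↑ y↑ R≐R
    with a≈b , t≈t ← ridge-injective x y x↑ y↑ R≐R | i ≟ i′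
  ... | yes refl = trans (rank-≈ a≈b i j) (cong (λ t → rank (b , i , t))
                     (trans (sym (≔-same a i j)) (trans (t≈t i) (≔-same b i j′))))
  ... | no i≢i′  = contradiction x↑ (ℕ.<-irrefl (cong toℕ (sym j≡ai)))
    where
    j≡ai : j ≡ a i
    j≡ai = trans (sym (≔-same a i j)) (trans (t≈t i) (trans (≔-other b i′ j′ i i≢i′) (sym (a≈b i))))

module _ {n} {c : Fin n → ℕ} where

  Shortcut : MonoSet c → Move c → Vert c → Set
  Shortcut M f v = ridge f v ≡ true × Σ (Move c) λ h → Exit M h × rank h <ᴸ rank f × ridge f ∖ v ⊆ ridge h

  ExitExchange : MonoSet c → Move c → Move c → Set
  ExitExchange M f g = Σ (Vert c) λ v → ridge g v ≡ false × Shortcut M f v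

avoid : ∀ {n} {c : Fin n → ℕ} {k} {x y : Fin (suc (c k))} →
  _≢_ {A = Vert c} (k , y) (k , x) → not ⌊ y ≟ x ⌋ ≡ true
avoid {x = x} {y} y≢x = cong not (⌊⌋-no (y ≟ x) (y≢x ∘ cong (_ ,_)))

module Shortcuts {n} {c : Fin (suc n) → ℕ} {M : MonoSet c} (closed : DownClosed M) where

  -- v = x₁^(x) for x below the first exponent of f: the exit h lowers that exponent to x
  shortcut-lower-first : ∀ (f : Move c) → Exit M f → ∀ x → toℕ x < toℕ (proj₁ f Fin.zero) →
    Shortcut M f (Fin.zero , x)
  shortcut-lower-first f@(a , Fin.suc p , j) (Ma , Mt) x x<a₁ =
    ∧-intro x∈Fa x∈Fa , shortcut (M (target f [ Fin.zero ≔ x ])) refl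
    where
    x∈Fa = Fc-contains a Fin.zero (<⇒≢ x<a₁)
    shortcut : ∀ b → M (target f [ Fin.zero ≔ x ]) ≡ b →
      Σ (Move c) λ h → Exit M h × rank h <ᴸ rank f × ridge f ∖ (Fin.zero , x) ⊆ ridge h
    shortcut false Mt′ = (a [ Fin.zero ≔ x ] , Fin.suc p , j) ,
      (lower-member closed Fin.zero x Ma (ℕ.<⇒≤ x<a₁) ,
       trans (member-≈ closed λ { Fin.zero → refl ; (Fin.suc k) → refl }) Mt′) ,
      this x<a₁ ,
      ∖-⊆-intro λ { (Fin.zero , y) _ w≢v → ∧-intro (avoid w≢v) (avoid w≢v) ; (Fin.suc k , y) Rf _ → Rf }
    shortcut true Mt′ = (target f [ Fin.zero ≔ x ] , Fin.zero , a Fin.zero) ,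
      (Mt′ , trans (member-≈ closed λ { Fin.zero → refl ; (Fin.suc k) → refl }) Mt) ,
      this x<a₁ ,
      ∖-⊆-intro λ { (Fin.zero , y) Rf w≢v → ∧-intro (avoid w≢v) (ridge-⊆-source f (Fin.zero , y) Rf)
                  ; w@(Fin.suc _ , _) Rf _ → ∧-intro (ridge-⊆-target f w Rf) (ridge-⊆-target f w Rf) }
  shortcut-lower-first f@(a , Fin.zero , j) ex@(Ma , Mt) x x<a₁ =
    ∧-intro (Fc-contains a Fin.zero (<⇒≢ x<a₁))
            (cong not (⌊⌋-no (x ≟ j) (<⇒≢ (ℕ.<-trans x<a₁ (exit-increasing closed f ex))))) ,
    (a [ Fin.zero ≔ x ] , Fin.zero , j) ,
    (lower-member closed Fin.zero x Ma (ℕ.<⇒≤ x<a₁) ,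
     trans (member-≈ closed λ { Fin.zero → refl ; (Fin.suc k) → refl }) Mt) ,
    this x<a₁ ,
    ∖-⊆-intro λ { w@(Fin.zero , _) Rf w≢v → ∧-intro (avoid w≢v) (ridge-⊆-target f w Rf)
                ; (Fin.suc k , y) Rf _ → Rf }

  -- v = x_{k+2}^(x) above the exponent of a, for a move of x₁: the exit h
  -- raises that exponent to x (and, if this stays in M, then also moves x₁)
  shortcut-raise : ∀ a j → Exit M (a , Fin.zero , j) → ∀ k x → toℕ (a (Fin.suc k)) < toℕ x →
    Shortcut M (a , Fin.zero , j) (Fin.suc k , x)
  shortcut-raise a j (Ma , Mt) k x a<x = x∈R , shortcut (M (a [ Fin.suc k ≔ x ])) refl
    where
    f = (a , Fin.zero , j)
    v = (Fin.suc k , x)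
    x∈R = ∧-intro (Fc-contains a (Fin.suc k) (<⇒≢ a<x ∘ sym)) (Fc-contains a (Fin.suc k) (<⇒≢ a<x ∘ sym))
    R∖v⊆Fr : ridge f ∖ v ⊆ Fc (a [ Fin.suc k ≔ x ])
    R∖v⊆Fr = ⊆-Fc-≔ a (Fin.suc k) x (⊆-trans (∖-⊆ {σ = ridge f}) (ridge-⊆-source f))
                                     (∖-self {σ = ridge f} {v = v})
    shortcut : ∀ b → M (a [ Fin.suc k ≔ x ]) ≡ b →
      Σ (Move c) λ h → Exit M h × rank h <ᴸ rank f × ridge f ∖ v ⊆ ridge h
    shortcut false Mr = (a , Fin.suc k , x) , (Ma , Mr) , next refl (this (s≤s z≤n)) ,
      λ w e → ∧-intro (ridge-⊆-source f w (∖-⊆ {σ = ridge f} {v = v} w e)) (R∖v⊆Fr w e)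
    shortcut true Mr = (a [ Fin.suc k ≔ x ] , Fin.zero , j) ,
      (Mr , above-outside closed Mt
              λ { Fin.zero → ℕ.≤-refl ; (Fin.suc k′) → ≔-raises (a ∘ Fin.suc) k x (ℕ.<⇒≤ a<x) k′ }) ,
      next refl (next refl (next refl (coexponents-raise (a ∘ Fin.suc) k x a<x))) ,
      λ { w@(Fin.zero , _) e → ∖-⊆ {σ = ridge f} {v = v} w e
        ; w@(Fin.suc _ , _) e → ∧-intro (R∖v⊆Fr w e) (R∖v⊆Fr w e) }

  -- v = x₁^(j′) strictly between the exponents of a move of x₁, with
  -- a[1≔j′] ∉ M: the exit h is the shorter move to j′
  shortcut-lower-target : ∀ a j → Exit M (a , Fin.zero , j) → ∀ j′ →
    toℕ (a Fin.zero) < toℕ j′ → toℕ j′ < toℕ j → M (a [ Fin.zero ≔ j′ ]) ≡ false →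
    Shortcut M (a , Fin.zero , j) (Fin.zero , j′)
  shortcut-lower-target a j (Ma , _) j′ a<j′ j′<j Mt′ =
    ∧-intro (Fc-contains a Fin.zero (<⇒≢ a<j′ ∘ sym)) (cong not (⌊⌋-no (j′ ≟ j) (<⇒≢ j′<j))) ,
    (a , Fin.zero , j′) , (Ma , Mt′) , next refl (next refl (this j′<j)) ,
    ∖-⊆-intro λ { w@(Fin.zero , _) Rf w≢v → ∧-intro (ridge-⊆-source (a , Fin.zero , j) w Rf) (avoid w≢v)
                ; (Fin.suc k , y) Rf _ → Rf }

  -- exchange for two moves of x₁ from the same exponent a₁, g to a smaller
  -- target j′: along x₁^(j′) if a[1≔j′] ∉ M; otherwise a[1≔j′] ∈ M and
  -- g's target ∉ M force a larger exponent of g past x₁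
  exchange-smaller-target : ∀ a a′ j j′ → Exit M (a , Fin.zero , j) → Exit M (a′ , Fin.zero , j′) →
    a′ Fin.zero ≡ a Fin.zero → toℕ j′ < toℕ j → ExitExchange M (a , Fin.zero , j) (a′ , Fin.zero , j′)
  exchange-smaller-target a a′ j j′ ef eg a′₁≡a₁ j′<j with M (a [ Fin.zero ≔ j′ ]) in Mt′
  ... | false =
    (Fin.zero , j′) , ridge-omits-target (a′ , Fin.zero , j′) Fin.zero ,
    shortcut-lower-target a j ef j′ a<j′ j′<j Mt′
    where a<j′ = subst (λ t → toℕ t < toℕ j′) a′₁≡a₁ (exit-increasing closed (a′ , Fin.zero , j′) eg)
  ... | true with outside-exceeds closed Mt′ (proj₂ eg)
  ...   | Fin.zero , j′<j′ = contradiction j′<j′ (ℕ.<-irrefl refl)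
  ...   | Fin.suc k , a<a′ =
    (Fin.suc k , a′ (Fin.suc k)) , ridge-omits-source (a′ , Fin.zero , j′) (Fin.suc k) ,
    shortcut-raise a j ef k _ a<a′

slice : ∀ {n} {c : Fin (suc n) → ℕ} → MonoSet c → Fin (suc (c Fin.zero)) → MonoSet (c ∘ Fin.suc)
slice M t b = M (cons t b)

module _ {n} {c : Fin (suc n) → ℕ} {M : MonoSet c} (closed : DownClosed M) where

  slice-closed : ∀ t → DownClosed (slice M t)
  slice-closed t u v Mu v∣u = closed (cons t u) (cons t v) Mu λ { Fin.zero → ℕ.≤-refl ; (Fin.suc k) → v∣u k }

  slice-exit : ∀ t b p j → b Fin.zero ≡ t → Exit M (b , Fin.suc p , j) →
    Exit (slice M t) (b ∘ Fin.suc , p , j)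
  slice-exit t b p j b₁≡t (Mb , Mt) =
    trans (member-≈ closed λ { Fin.zero → sym b₁≡t ; (Fin.suc k) → refl }) Mb ,
    trans (member-≈ closed λ { Fin.zero → sym b₁≡t ; (Fin.suc k) → refl }) Mt

  unslice : Fin (suc (c Fin.zero)) → Move (c ∘ Fin.suc) → Move c
  unslice t (b , p , j) = cons t b , Fin.suc p , j

  unslice-exit : ∀ t (h : Move (c ∘ Fin.suc)) → Exit (slice M t) h → Exit M (unslice t h)
  unslice-exit t h (Mb , Mt) = Mb , trans (member-≈ closed λ { Fin.zero → refl ; (Fin.suc k) → refl }) Mt

  unslice-⊆ : ∀ a p j (h : Move (c ∘ Fin.suc)) k x →
    ridge (a ∘ Fin.suc , p , j) ∖ (k , x) ⊆ ridge h →
    ridge (a , Fin.suc p , j) ∖ (Fin.suc k , x) ⊆ ridge (unslice (a Fin.zero) h)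
  unslice-⊆ a p j (b , q , y′) k x R∖v⊆R w@(Fin.zero , _) e = ∖-⊆ {σ = ridge f} {v = v} w e
    where f = (a , Fin.suc p , j) ; v = (Fin.suc k , x)
  unslice-⊆ a p j (b , q , y′) k x R∖v⊆R w@(Fin.suc k′ , y) e =
    R∖v⊆R (k′ , y) (∖-intro {σ = ridge (a ∘ Fin.suc , p , j)} {v = k , x} {w = k′ , y}
                       (∖-⊆ {σ = ridge f} {v = v} w e) (∖-avoids {σ = ridge f} {v = v} {w = w} e ∘ cong lift))
    where f = (a , Fin.suc p , j) ; v = (Fin.suc k , x)

exchange : ∀ {n} {c : Fin n → ℕ} {M : MonoSet c} → DownClosed M →
  ∀ (f g : Move c) → Exit M f → Exit M g → rank g <ᴸ rank f → ExitExchange M f g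
exchange {zero} _ (_ , () , _) _ _ _ _
exchange {suc n} closed f g ef eg (this g₁<f₁) =
  (Fin.zero , proj₁ g Fin.zero) , ridge-omits-source g Fin.zero ,
  Shortcuts.shortcut-lower-first closed f ef _ g₁<f₁
-- f moves x₁, g a later variable: the target of g exceeds a past x₁
exchange {suc n} closed (a , Fin.zero , j) g@(_ , Fin.suc _ , _) ef eg (next g₁≡a₁ _)
  with outside-exceeds closed (proj₁ ef) (proj₂ eg)
... | Fin.zero , a<t  = contradiction (sym g₁≡a₁) (ℕ.<⇒≢ a<t)
... | Fin.suc k , a<t =
  (Fin.suc k , target g (Fin.suc k)) , ridge-omits-target g (Fin.suc k) ,
  Shortcuts.shortcut-raise closed a j ef k _ a<t
exchange {suc n} closed (_ , Fin.suc _ , _) (_ , Fin.zero , _) ef eg (next _ (this ()))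
exchange {suc n} closed (_ , Fin.suc _ , _) (_ , Fin.zero , _) ef eg (next _ (next () _))
exchange {suc n} closed (_ , Fin.zero , _) (_ , Fin.zero , _) ef eg (next _ (this (s≤s ())))
exchange {suc n} closed (a , Fin.zero , j) (a′ , Fin.zero , j′) ef eg (next g₁≡a₁ (next _ (this j′<j))) =
  Shortcuts.exchange-smaller-target closed a a′ j j′ ef eg (toℕ-injective g₁≡a₁) j′<j
-- both move x₁ to the same target, g from a larger exponent past x₁
exchange {suc n} closed (a , Fin.zero , j) g@(a′ , Fin.zero , _) ef eg (next _ (next _ (next _ lt)))
  with k , a<a′ ← coexponents-< (a ∘ Fin.suc) (a′ ∘ Fin.suc) lt =
  (Fin.suc k , a′ (Fin.suc k)) , ridge-omits-source g (Fin.suc k) ,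
  Shortcuts.shortcut-raise closed a j ef k _ a<a′
-- neither moves x₁: induction in the slice at a₁
exchange {suc n} closed (a , Fin.suc p , j) (a′ , Fin.suc p′ , j′) ef eg (next g₁≡a₁ (next _ lt))
  with (k , x) , Rg , Rf , h , eh , h<f , R∖v⊆Rh ←
         exchange (slice-closed closed (a Fin.zero)) (a ∘ Fin.suc , p , j) (a′ ∘ Fin.suc , p′ , j′)
                  (slice-exit closed _ a p j refl ef)
                  (slice-exit closed _ a′ p′ j′ (toℕ-injective g₁≡a₁) eg) lt
  = (Fin.suc k , x) , Rg , Rf , unslice closed (a Fin.zero) h , unslice-exit closed (a Fin.zero) h eh ,
    next refl (next refl h<f) , unslice-⊆ closed a p j h k x R∖v⊆Rh

allMono : ∀ {n} (c : Fin n → ℕ) → List (Mono c)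
allMono {zero}  c = (λ ()) ∷ []
allMono {suc n} c = concatMap (λ t → map (cons t) (allMono (c ∘ Fin.suc))) (allFin (suc (c Fin.zero)))

allMono-complete : ∀ {n} (c : Fin n → ℕ) (a : Mono c) → Any (_≈ᵐ a) (allMono c)
allMono-complete {zero}  c a = here (λ ())
allMono-complete {suc n} c a =
  AnyP.concatMap⁺ _ (lose (∈-allFin (a Fin.zero))
    (AnyP.map⁺ (Any.map (λ b≈a → λ { Fin.zero → refl ; (Fin.suc k) → b≈a k })
                        (allMono-complete (c ∘ Fin.suc) (a ∘ Fin.suc)))))

allMoves : ∀ {n} (c : Fin n → ℕ) → List (Move c)
allMoves {n} c =
  concatMap (λ a → concatMap (λ i → map (λ j → a , i , j) (allFin (suc (c i)))) (allFin n)) (allMono c)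

allMoves-complete : ∀ {n} {c : Fin n → ℕ} (x : Move c) →
  Any (λ y → proj₁ y ≈ᵐ proj₁ x × proj₂ y ≡ proj₂ x) (allMoves c)
allMoves-complete {c = c} (a , i , j) =
  AnyP.concatMap⁺ _ (Any.map (λ b≈a → AnyP.concatMap⁺ _ (lose (∈-allFin i)
                                        (AnyP.map⁺ (lose (∈-allFin j) (b≈a , refl)))))
                    (allMono-complete c a))

module Shelling {n} {c : Fin n → ℕ} {M : MonoSet c} (closed : DownClosed M) where

  open BierFacets closed
  open SortByKey (rank {c = c}) <ᴸ-compare <ᴸ-trans

  exit? : (x : Move c) → Dec (Exit M x)
  exit? x = (M (proj₁ x) Bool.≟ true) ×-dec (M (target x) Bool.≟ false)

  -- one exit of each rank, sorted
  exits : List (Move c)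
  exits = sort (filter exit? (allMoves c))

  exits-sorted : Sorted exits
  exits-sorted = sort-sorted (filter exit? (allMoves c))

  exits-exit : All (Exit M) exits
  exits-exit = All.tabulate λ x∈ →
    proj₂ (∈-filter⁻ exit? {xs = allMoves c} (sort-⊆ (filter exit? (allMoves c)) x∈))

  exits-complete : ∀ x → Exit M x → Any (λ y → rank y ≡ rank x) exits
  exits-complete x@(a , i , j) ex with y , y∈ , b≈a , refl ← find (allMoves-complete x) =
    Any.map (λ ry≡rz → trans ry≡rz (rank-≈ b≈a i j))
            (sort-complete _ (∈-filter⁺ exit? y∈ (trans (member-≈ closed b≈a) (proj₁ ex) ,
                                                 trans (member-≈ closed (≔-cong b≈a i j)) (proj₂ ex))))

  d : ℕ
  d = ∣ c ∣ᶜ ∸ 1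

  card-exit-ridge : ∀ x → Exit M x → card (ridge x) ≡ d
  card-exit-ridge x ex = trans (sym (ℕ.m+n∸n≡m (card (ridge x)) 1)) (cong (_∸ 1) (card-ridge x ex))

  pure : IsPure d (Bier c M)
  pure = (λ σ σ∈ → let x , ex , σ⊆R = Bier-face-in-ridge σ σ∈ in ridge x , ridge-facet x ex , σ⊆R) ,
         (λ F F-facet → let x , ex , F≐R = facet-ridge F-facet in
                        trans (card-≐ F≐R) (card-exit-ridge x ex))

  distinct : ∀ xs → Sorted xs → All (Exit M) xs → AllPairs (λ x y → ¬ ridge x ≐ ridge y) xs
  distinct []       []              []          = []
  distinct (x ∷ xs) (x<xs ∷ sorted) (ex ∷ exs) =
    All.zipWith (λ { (x<y , ey) R≐R → <-irrefl (subst (rank x <ᴸ_) (sym (same-rank ey R≐R)) x<y) }) (x<xs , exs)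
    ∷ distinct xs sorted exs
    where
    same-rank : ∀ {y} → Exit M y → ridge x ≐ ridge y → rank x ≡ rank y
    same-rank {y} ey = ridge-determines-rank x y (exit-increasing closed x ex) (exit-increasing closed y ey)

  facet-order : IsFacetOrder (Bier c M) (map ridge exits)
  facet-order =
    AllP.map⁺ (All.map (λ {x} → ridge-facet x) exits-exit) ,
    (λ F F-facet → let x , ex , F≐R = facet-ridge F-facet in
      AnyP.map⁺ (Any.map (λ {y} ry≡rx w → trans (F≐R w) (rank-determines-ridge x y (sym ry≡rx) w))
                         (exits-complete x ex))) ,
    APP.map⁺ (distinct exits exits-sorted exits-exit)

  module _ {pre f post} (split : exits ≡ pre ++ f ∷ post) where

    split-sorted : Sorted (pre ++ f ∷ post)
    split-sorted = subst Sorted split exits-sorted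

    split-exit : ∀ {x} → x ∈ pre ++ f ∷ post → Exit M x
    split-exit x∈ = All.lookup exits-exit (subst (_ ∈_) (sym split) x∈)

  -- every exit f admits an exchange against each exit ranked before it:
  -- the exit h of the exchange lemma is ranked before f, so its rank is
  -- carried by an exit preceding f in the list
  exchanges : ∀ pre f post → exits ≡ pre ++ f ∷ post →
    ∀ {g} → g ∈ pre → Exchange (map ridge pre) (ridge f) (ridge g)
  exchanges pre f post split {g} g∈pre
    with v , Rg , Rf , h , eh , h<f , R∖v⊆Rh ←
           exchange closed f g (split-exit split (∈-++⁺ʳ pre (here refl))) (split-exit split (∈-++⁺ˡ g∈pre))
                    (sorted-before pre (split-sorted split) g∈pre)
    with y , y∈ , ry≡rh ← find (exits-complete h eh)
    = v , Rf , Rg , AnyP.map⁺ (lose y∈pre (⊆-trans R∖v⊆Rh (≐⇒⊆ (rank-determines-ridge h y (sym ry≡rh)))))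
    where
    y∈pre = below-in-prefix pre (split-sorted split) (subst (y ∈_) split y∈) (subst (_<ᴸ rank f) (sym ry≡rh) h<f)

  shelling : IsShelling d (map ridge exits)
  shelling = shelling-criterion ridge exits d (All.map (λ {x} → card-exit-ridge x) exits-exit) exchanges

theorem2p1 : (n : ℕ) → 1 ≤ n → (c : Fin n → ℕ) → (M : MonoSet c) →
    IsMulticomplex c M → IsProper c M → IsShellable (Bier c M)
theorem2p1 n _ c M (_ , closed) _ = d , pure , map ridge exits , facet-order , shelling
  where open Shelling closed
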